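{- Let $n\ge3$ be finite, let $\Gamma,\Delta$ be graphs and $f:\Gamma\to\Delta$ a surjective graph p-morphism. Let $f^\times:\Gamma\times n\to\Delta\times n$ be $f^\times(p,i)=(f(p),i)$, and define $\widehat f:\mathrm{At}(\Gamma)\to\mathrm{At}(\Delta)$ by $\widehat f(K,\sim)=(f^\times\circ K,\sim)$. Then $\widehat f$ is a well-defined surjective p-morphism of atom structures.
   Context: Graphs are undirected and loop-free. A map $f:\Gamma\to\Delta$ of graphs is a graph p-morphism if for each $x\in\Gamma$, $f$ maps the set of neighbours of $x$ surjectively onto the set of neighbours of $f(x)$. For a graph $\Gamma=(V,E)$, $\Gamma\times n$ has vertices $V\times n$ with an edge between $(x,i),(y,j)$ iff $E(x,y)$ or $i\ne j$. $S(\Gamma)$ is the set of pairs $(K,\sim)$, $\sim$ an equivalence relation on $n$, $K$ a partial map $n\to\Gamma\times n$: if $|n/{\sim}|=n$, $K$ is total with non-independent image; if $|n/{\sim}|=n-1$ with two-element class $\{i,j\}$, $\mathrm{dom}K=\{i,j\}$ and $K(i)=K(j)$; otherwise $K=\emptyset$. "$K(i)=K'(j)$" means both undefined or both defined and equal; $\sim$ is $i$-distinguishing if no distinct $j,k\ne i$ are $\sim$-related. $\mathrm{At}(\Gamma)=(S(\Gamma),D_{ij},\equiv_i,(-)^\sigma)_{i,j<n,\sigma:n\to n}$ where $D_{ij}=\{(K,\sim):i\sim j\}$; $(K,\sim)\equiv_i(K',\sim')$ iff $K(i)=K'(i)$ and $\sim,\sim'$ agree on $n\setminus\{i\}$; $(K,\sim)^\sigma=(K^\sigma,\sim^\sigma)$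 with $i\sim^\sigma j$ iff $\sigma(i)\sim\sigma(j)$, and $K^\sigma(i)$ defined iff $\sim^\sigma$ is $i$-distinguishing, in which case $K^\sigma(i)=K(j)$ for the unique $j\notin\sigma[n\setminus\{i\}]$. This is regarded as a relational structure with unary relations $R_{d_{ij}}=D_{ij}$, binary $R_{c_i}={\equiv_i}$, and binary $R_{s_\sigma}(s,t)$ iff $t^\sigma=s$. A map $g:\mathcal S\to\mathcal S'$ between such structures is a p-morphism of atom structures if for each relation symbol $R_f$ of arity $m+1$: (forth) $R_f(x_1,\dots,x_m,y)$ implies $R_f(g(x_1),\dots,g(x_m),g(y))$; (back) if $R_f(x_1',\dots,x_m',g(y))$ in $\mathcal S'$ then there are $x_1,\dots,x_m$ with $R_f(x_1,\dots,x_m,y)$ and $g(x_k)=x_k'$. -}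

module Defs where

open import Data.Nat using (ℕ; _∸_)
open import Data.Bool using (Bool; true; false; _∧_; _∨_; not; if_then_else_)
open import Data.Fin using (Fin; toℕ; _≟_)
open import Data.Nat using (_<ᵇ_)
open import Data.Maybe using (Maybe; just; nothing)
import Data.Maybe as Maybe
open import Data.Product using (Σ; ∃; ∃-syntax; _×_; _,_; proj₁; proj₂; map₁)
open import Data.Sum using (_⊎_)
open import Data.Vec using (Vec; lookup; tabulate)
import Data.Vec as Vec
open import Data.List using (List; length; filterᵇ; head)
open import Data.Bool.ListAction using (all)
open import Data.List using () renaming (allFin to allFinL)
open import Relation.Nullary using (¬_; does)
open import Relation.Binary.PropositionalEquality using (_≡_; _≢_)

record Graph : Set₁ where
  field
    V     : Set
    E     : V → V → Set
    E-sym : ∀ {x y} → E x y → E y x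
    E-irr : ∀ x → ¬ E x x
open Graph public

IsGraphPMorphism : (Γ Δ : Graph) → (V Γ → V Δ) → Set
IsGraphPMorphism Γ Δ f =
  ∀ x → (∀ y → E Γ x y → E Δ (f x) (f y))
      × (∀ y' → E Δ (f x) y' → ∃[ y ] (E Γ x y × f y ≡ y'))

IsSurjective : {A B : Set} → (A → B) → Set
IsSurjective {A} {B} f = ∀ (b : B) → ∃[ a ] (f a ≡ b)

Vx : Graph → ℕ → Set
Vx Γ n = V Γ × Fin n

Ex : (Γ : Graph) (n : ℕ) → Vx Γ n → Vx Γ n → Set
Ex Γ n (x , i) (y , j) = E Γ x y ⊎ i ≢ j

-- Raw atoms: pairs (K , ∼) with K a partial map n → Γ × n (a vector of
-- Maybe's) and ∼ a Boolean-valued relation on n (an n×n Boolean matrix).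

PMap : Graph → ℕ → Set
PMap Γ n = Vec (Maybe (Vx Γ n)) n

BRel : ℕ → Set
BRel n = Vec (Vec Bool n) n

Raw : Graph → ℕ → Set
Raw Γ n = PMap Γ n × BRel n

relᵇ : ∀ {n} → BRel n → Fin n → Fin n → Bool
relᵇ R i j = lookup (lookup R i) j

rel : ∀ {n} → BRel n → Fin n → Fin n → Set
rel R i j = relᵇ R i j ≡ true

IsEquivRel : ∀ {n} → BRel n → Set
IsEquivRel {n} R =
  (∀ i → rel R i i) × (∀ i j → rel R i j → rel R j i)
  × (∀ i j k → rel R i j → rel R j k → rel R i k)

eqᵇ : ∀ {n} → Fin n → Fin n → Bool
eqᵇ i j = does (i ≟ j)

-- |n/∼| : the number of i that are least (in the usual order) in their class
numClasses : ∀ {n} → BRel n → ℕ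
numClasses {n} R =
  length (filterᵇ (λ i → all (λ j → not ((toℕ j <ᵇ toℕ i) ∧ relᵇ R j i)) (allFinL n))
                  (allFinL n))

IsJust : {A : Set} → Maybe A → Set
IsJust {A} m = ∃[ a ] (m ≡ just a)

NonIndependent : ∀ {Γ n} → PMap Γ n → Set
NonIndependent {Γ} {n} K =
  ∃[ i ] ∃[ j ] ∃[ p ] ∃[ q ]
    (lookup K i ≡ just p × lookup K j ≡ just q × Ex Γ n p q)

IsAtom : (Γ : Graph) (n : ℕ) → Raw Γ n → Set
IsAtom Γ n (K , R) =
  IsEquivRel R
  × (numClasses R ≡ n → (∀ i → IsJust (lookup K i)) × NonIndependent {Γ} K)
  × (numClasses R ≡ n ∸ 1 →
       ∃[ i ] ∃[ j ] (i ≢ j × rel R i j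
         × (∀ k → rel R i k → k ≡ i ⊎ k ≡ j)
         × (∀ k → (IsJust (lookup K k) → k ≡ i ⊎ k ≡ j)
                × (k ≡ i ⊎ k ≡ j → IsJust (lookup K k)))
         × lookup K i ≡ lookup K j))
  × (numClasses R ≢ n → numClasses R ≢ n ∸ 1 → ∀ i → lookup K i ≡ nothing)

Dᵣ : ∀ {Γ n} → Fin n → Fin n → Raw Γ n → Set
Dᵣ i j (K , R) = rel R i j

Cᵣ : ∀ {Γ n} → Fin n → Raw Γ n → Raw Γ n → Set
Cᵣ i (K , R) (K' , R') =
  lookup K i ≡ lookup K' i
  × (∀ j k → j ≢ i → k ≢ i → relᵇ R j k ≡ relᵇ R' j k)

subRel : ∀ {n} → (Fin n → Fin n) → BRel n → BRel n
subRel σ R = tabulate λ i → tabulate λ j → relᵇ R (σ i) (σ j)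

distinguishingᵇ : ∀ {n} → BRel n → Fin n → Bool
distinguishingᵇ {n} R i =
  all (λ j → all (λ k → eqᵇ j i ∨ eqᵇ k i ∨ eqᵇ j k ∨ not (relᵇ R j k))
                 (allFinL n)) (allFinL n)

-- the (first, and in the relevant case unique) j ∉ σ[n ∖ {i}]
missing : ∀ {n} → (Fin n → Fin n) → Fin n → Maybe (Fin n)
missing {n} σ i =
  head (filterᵇ (λ j → all (λ k → eqᵇ k i ∨ not (eqᵇ (σ k) j)) (allFinL n))
                (allFinL n))

subK : ∀ {Γ n} → (Fin n → Fin n) → Raw Γ n → PMap Γ n
subK σ (K , R) = tabulate λ i →
  if distinguishingᵇ (subRel σ R) i
  then Maybe.maybe (lookup K) nothing (missing σ i)
  else nothing

sub : ∀ {Γ n} → (Fin n → Fin n) → Raw Γ n → Raw Γ n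
sub {Γ} σ (K , R) = subK {Γ} σ (K , R) , subRel σ R

Sᵣ : ∀ {Γ n} → (Fin n → Fin n) → Raw Γ n → Raw Γ n → Set
Sᵣ {Γ} σ s t = sub {Γ} σ t ≡ s

IsAtPMorphism : (Γ Δ : Graph) (n : ℕ) → (Raw Γ n → Raw Δ n) → Set
IsAtPMorphism Γ Δ n g =
  (∀ i j y → IsAtom Γ n y → Dᵣ {Γ} i j y → Dᵣ {Δ} i j (g y))
  × (∀ i j y → IsAtom Γ n y → Dᵣ {Δ} i j (g y) → Dᵣ {Γ} i j y)
  × (∀ i x y → IsAtom Γ n x → IsAtom Γ n y → Cᵣ {Γ} i x y → Cᵣ {Δ} i (g x) (g y))
  × (∀ i x' y → IsAtom Δ n x' → IsAtom Γ n y → Cᵣ {Δ} i x' (g y) →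
       ∃[ x ] (IsAtom Γ n x × Cᵣ {Γ} i x y × g x ≡ x'))
  × (∀ σ x y → IsAtom Γ n x → IsAtom Γ n y → Sᵣ {Γ} σ x y → Sᵣ {Δ} σ (g x) (g y))
  × (∀ σ x' y → IsAtom Δ n x' → IsAtom Γ n y → Sᵣ {Δ} σ x' (g y) →
       ∃[ x ] (IsAtom Γ n x × Sᵣ {Γ} σ x y × g x ≡ x'))

f× : ∀ {Γ Δ n} → (V Γ → V Δ) → Vx Γ n → Vx Δ n
f× f = map₁ f

fhat : ∀ {Γ Δ n} → (V Γ → V Δ) → Raw Γ n → Raw Δ n
fhat {Γ} {Δ} {n} f (K , R) = Vec.map (Maybe.map (f× {Γ} {Δ} {n} f)) K , R

-- f̂ only rewrites the partial map K pointwise by f^×, so it commutes with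
-- substitution and preserves everything defined from ∼; the forth conditions are
-- bookkeeping. The back conditions and surjectivity need lifts: a Δ-atom
-- (K′ , ∼) is lifted pointwise through a section of f, constantly on the
-- ∼-class of a prescribed index, and in the total case one endpoint of the
-- edge witnessing non-independence is re-lifted along an edge of Γ, which the
-- p-morphism back condition provides. For s-back, y^σ is an atom as soon as its
-- image is: if the image is total, every index is ∼^σ-distinguishing, which for
-- n ≥ 3 makes ∼^σ discrete and σ a bijection, so K^σ = K ∘ σ is non-independent
-- because K is.
module Submission where

open import Defs
open import Data.Bool using (Bool; true; false; T; not; _∧_; _∨_; if_then_else_)
open import Data.Bool.Properties using (T-≡)
open import Data.Bool.ListAction using (all)
open import Data.Empty using (⊥; ⊥-elim)
open import Data.Fin using (Fin; zero; suc; toℕ; _≟_; punchOut; fromℕ<)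
import Data.Fin.Properties as Finₚ
open import Data.List using (head; length) renaming (allFin to allFinL)
import Data.List.Properties as List
open import Data.List.Membership.Propositional using (lose)
open import Data.List.Membership.Propositional.Properties using (∈-allFin)
open import Data.List.Relation.Unary.All as All using (All; _∷_)
open import Data.List.Relation.Unary.All.Properties using (all⁺; all⁻; all-filter)
open import Data.Maybe using (Maybe; just; nothing)
import Data.Maybe as Maybe
open import Data.Maybe.Properties using (just-injective)
open import Data.Nat using (ℕ; zero; suc; _∸_; _≤_; _<_; _<ᵇ_; s≤s)
import Data.Nat.Properties as ℕ
open import Data.Product using (∃-syntax; _×_; _,_; proj₁; proj₂)
open import Data.Sum using (_⊎_; inj₁; inj₂; map₁)
open import Data.Unit using (tt)
open import Data.Vec using (Vec; lookup; tabulate; _[_]≔_)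
import Data.Vec as Vec
import Data.Vec.Properties as Vec
open import Function using (_∘_; Equivalence)
open import Function.Definitions using (Injective)
open import Relation.Binary.Definitions using (tri<; tri≈; tri>)
open import Relation.Binary.PropositionalEquality
open import Relation.Nullary using (¬_; Dec; yes; no)
open import Relation.Nullary.Decidable using (T?; _⊎-dec_)

open Equivalence using (from)

lookup-ext : ∀ {A : Set} {n} {xs ys : Vec A n} → (∀ i → lookup xs i ≡ lookup ys i) → xs ≡ ys
lookup-ext {xs = xs} {ys} eq = begin
  xs                   ≡⟨ Vec.tabulate∘lookup xs ⟨
  tabulate (lookup xs) ≡⟨ Vec.tabulate-cong eq ⟩
  tabulate (lookup ys) ≡⟨ Vec.tabulate∘lookup ys ⟩
  ys                   ∎
  where open ≡-Reasoning

head-All : ∀ {A : Set} {P : A → Set} {xs x} → All P xs → head xs ≡ just x → P x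
head-All (px ∷ _) refl = px

IsJust-map⁺ : ∀ {A B : Set} {h : A → B} {m} → IsJust m → IsJust (Maybe.map h m)
IsJust-map⁺ {h = h} (a , refl) = h a , refl

IsJust-map⁻ : ∀ {A B : Set} {h : A → B} {m} → IsJust (Maybe.map h m) → IsJust m
IsJust-map⁻ {m = just a} _ = a , refl

map-nothing⁻ : ∀ {A B : Set} {h : A → B} {m} → Maybe.map h m ≡ nothing → m ≡ nothing
map-nothing⁻ {m = nothing} _ = refl

map-just⁻ : ∀ {A B : Set} {h : A → B} {m b} → Maybe.map h m ≡ just b → ∃[ a ] (m ≡ just a × h a ≡ b)
map-just⁻ {m = just a} refl = a , refl , refl

false≢true : false ≢ true
false≢true ()

not-both : ∀ {a b} → T (not (a ∧ b)) → T a → T b → ⊥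
not-both {true} {true} ()

-- A missed m lets σ be punched down to an injection Fin (suc n) → Fin n.
injective⇒surjective : ∀ {n} {σ : Fin n → Fin n} → Injective _≡_ _≡_ σ → ∀ m → ∃[ k ] σ k ≡ m
injective⇒surjective {suc n} {σ} σ-inj m with Finₚ.any? (λ k → σ k ≟ m)
... | yes hit = hit
... | no miss = ⊥-elim (ℕ.1+n≰n (Finₚ.injective⇒≤ squeeze-injective))
  where
  squeeze : Fin (suc n) → Fin n
  squeeze k = punchOut {i = m} {j = σ k} (λ e → miss (k , sym e))
  squeeze-injective : Injective _≡_ _≡_ squeeze
  squeeze-injective {x} {y} e = σ-inj (Finₚ.punchOut-injective (λ e → miss (x , sym e)) (λ e → miss (y , sym e)) e)

∃-distinct-from : ∀ {n} → 3 ≤ n → (j k : Fin n) → ∃[ i ] (i ≢ j × i ≢ k)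
∃-distinct-from (s≤s (s≤s (s≤s _))) j k with zero ≟ j | zero ≟ k
... | no 0≢j | no 0≢k = zero , 0≢j , 0≢k
... | yes refl | _ with suc zero ≟ k
...   | no 1≢k = suc zero , (λ ()) , 1≢k
...   | yes refl = suc (suc zero) , (λ ()) , (λ ())
∃-distinct-from (s≤s (s≤s (s≤s _))) j k | no _ | yes refl with suc zero ≟ j
... | no 1≢j = suc zero , 1≢j , (λ ())
... | yes refl = suc (suc zero) , (λ ()) , (λ ())

n≢n∸1 : ∀ {n} → Fin n → n ≢ n ∸ 1
n≢n∸1 {suc _} _ = ℕ.1+n≢n

module _ {n : ℕ} where

  Discrete : BRel n → Set
  Discrete R = ∀ {i j} → rel R i j → i ≡ j

  isLeastᵇ : BRel n → Fin n → Bool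
  isLeastᵇ R i = all (λ j → not ((toℕ j <ᵇ toℕ i) ∧ relᵇ R j i)) (allFinL n)

  numClasses<n : ∀ {R i j} → rel R i j → toℕ i < toℕ j → numClasses R < n
  numClasses<n {R} {i} {j} r i<j =
    subst (numClasses R <_) (List.length-tabulate {n = n} (λ k → k))
      (List.filter-notAll (T? ∘ isLeastᵇ R) (allFinL n) (lose (∈-allFin j) j-not-least))
    where
    j-not-least : ¬ T (isLeastᵇ R j)
    j-not-least t = not-both (All.lookup (all⁺ _ _ t) (∈-allFin i)) (ℕ.<⇒<ᵇ i<j) (from T-≡ r)

  numClasses≡n⇒discrete : ∀ {R} → IsEquivRel R → numClasses R ≡ n → Discrete R
  numClasses≡n⇒discrete {R} (_ , sym′ , _) c {i} {j} r with Finₚ.<-cmp i j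
  ... | tri≈ _ i≡j _ = i≡j
  ... | tri< i<j _ _ = ⊥-elim (ℕ.<-irrefl c (numClasses<n {R} r i<j))
  ... | tri> _ _ j<i = ⊥-elim (ℕ.<-irrefl c (numClasses<n {R} (sym′ i j r) j<i))

  discrete⇒numClasses≡n : ∀ {R} → Discrete R → numClasses R ≡ n
  discrete⇒numClasses≡n {R} discrete =
    trans (cong length (List.filter-all (T? ∘ isLeastᵇ R) {allFinL n} (All.tabulate λ {i} _ → least i)))
          (List.length-tabulate {n = n} (λ k → k))
    where
    unrelated-below : ∀ i j → T (not ((toℕ j <ᵇ toℕ i) ∧ relᵇ R j i))
    unrelated-below i j with toℕ j <ᵇ toℕ i in lt | relᵇ R j i in r
    ... | false | _ = tt
    ... | true | false = tt
    ... | true | true = ⊥-elim (ℕ.<-irrefl (cong toℕ (discrete r)) (ℕ.<ᵇ⇒< _ _ (from T-≡ lt)))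
    least : ∀ i → T (isLeastᵇ R i)
    least i = all⁻ _ {xs = allFinL n} (All.tabulate λ {j} _ → unrelated-below i j)

  distinguishing-sound : ∀ {S : BRel n} {i j k} → T (distinguishingᵇ S i) → rel S j k →
    j ≡ k ⊎ (j ≡ i ⊎ k ≡ i)
  distinguishing-sound {S} {i} {j} {k} d r =
    decode (All.lookup (all⁺ _ _ (All.lookup (all⁺ _ _ d) (∈-allFin j))) (∈-allFin k))
    where
    decode : T (eqᵇ j i ∨ eqᵇ k i ∨ eqᵇ j k ∨ not (relᵇ S j k)) → j ≡ k ⊎ (j ≡ i ⊎ k ≡ i)
    decode t with j ≟ i | k ≟ i | j ≟ k
    ... | yes j≡i | _ | _ = inj₂ (inj₁ j≡i)
    ... | no _ | yes k≡i | _ = inj₂ (inj₂ k≡i)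
    ... | no _ | no _ | yes j≡k = inj₁ j≡k
    ... | no _ | no _ | no _ = ⊥-elim (subst (T ∘ not) r t)

  everywhere-distinguishing⇒discrete : ∀ {S} → 3 ≤ n → (∀ i → T (distinguishingᵇ S i)) → Discrete S
  everywhere-distinguishing⇒discrete {S} n≥3 d {j} {k} r
    with i , i≢j , i≢k ← ∃-distinct-from n≥3 j k
    with distinguishing-sound {S} (d i) r
  ... | inj₁ j≡k = j≡k
  ... | inj₂ (inj₁ j≡i) = ⊥-elim (i≢j (sym j≡i))
  ... | inj₂ (inj₂ k≡i) = ⊥-elim (i≢k (sym k≡i))

  relᵇ-subRel : ∀ (σ : Fin n → Fin n) (R : BRel n) j k → relᵇ (subRel σ R) j k ≡ relᵇ R (σ j) (σ k)
  relᵇ-subRel σ R j k =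
    trans (cong (λ row → lookup row k) (Vec.lookup∘tabulate (λ i → tabulate λ j → relᵇ R (σ i) (σ j)) j))
          (Vec.lookup∘tabulate (λ k → relᵇ R (σ j) (σ k)) k)

  subRel-identifies : ∀ σ R {j k} → IsEquivRel R → σ j ≡ σ k → rel (subRel σ R) j k
  subRel-identifies σ R {j} {k} (refl′ , _) σj≡σk =
    trans (relᵇ-subRel σ R j k) (subst (rel R (σ j)) σj≡σk (refl′ (σ j)))

  two-distinguishing⇒injective : ∀ {σ R a b} → IsEquivRel R →
    T (distinguishingᵇ (subRel σ R) a) → T (distinguishingᵇ (subRel σ R) b) → σ a ≢ σ b →
    Injective _≡_ _≡_ σ
  two-distinguishing⇒injective {σ} {R} {a} {b} eqv da db σa≢σb {j} {k} σj≡σk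
    with distinguishing-sound {subRel σ R} da (subRel-identifies σ R {j} {k} eqv σj≡σk)
       | distinguishing-sound {subRel σ R} db (subRel-identifies σ R {j} {k} eqv σj≡σk)
  ... | inj₁ j≡k | _ = j≡k
  ... | inj₂ _ | inj₁ j≡k = j≡k
  ... | inj₂ at-a | inj₂ at-b = ⊥-elim (σa≢σb (trans (hit at-a) (sym (hit at-b))))
    where
    hit : ∀ {x} → j ≡ x ⊎ k ≡ x → σ x ≡ σ j
    hit (inj₁ refl) = refl
    hit (inj₂ refl) = sym σj≡σk

  missesᵇ : (Fin n → Fin n) → Fin n → Fin n → Bool
  missesᵇ σ i j = all (λ k → eqᵇ k i ∨ not (eqᵇ (σ k) j)) (allFinL n)

  missesᵇ-sound : ∀ σ {i j k} → T (missesᵇ σ i j) → k ≢ i → σ k ≢ j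
  missesᵇ-sound σ {i} {j} {k} t = decode (All.lookup (all⁺ _ _ t) (∈-allFin k))
    where
    decode : T (eqᵇ k i ∨ not (eqᵇ (σ k) j)) → k ≢ i → σ k ≢ j
    decode t with k ≟ i | σ k ≟ j
    ... | yes k≡i | _ = λ k≢i → ⊥-elim (k≢i k≡i)
    ... | no _ | no σk≢j = λ _ → σk≢j
    ... | no _ | yes _ = ⊥-elim t

  missesᵇ-complete : ∀ σ {i j} → (∀ {k} → k ≢ i → σ k ≢ j) → T (missesᵇ σ i j)
  missesᵇ-complete σ {i} {j} avoids = all⁻ _ {xs = allFinL n} (All.tabulate λ {k} _ → encode k)
    where
    encode : ∀ k → T (eqᵇ k i ∨ not (eqᵇ (σ k) j))
    encode k with k ≟ i
    ... | yes _ = tt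
    ... | no k≢i with σ k ≟ j
    ...   | yes σk≡j = ⊥-elim (avoids k≢i σk≡j)
    ...   | no _ = tt

  missing-avoids : ∀ {σ i m k} → missing σ i ≡ just m → k ≢ i → σ k ≢ m
  missing-avoids {σ} {i} e = missesᵇ-sound σ (head-All (all-filter (T? ∘ missesᵇ σ i) (allFinL n)) e)

  missing-injective : ∀ {σ i m} → Injective _≡_ _≡_ σ → missing σ i ≡ just m → m ≡ σ i
  missing-injective {σ} {i} {m} σ-inj e with k , σk≡m ← injective⇒surjective σ-inj m | k ≟ i
  ... | yes refl = sym σk≡m
  ... | no k≢i = ⊥-elim (missing-avoids {σ} e k≢i σk≡m)

  missing-cong : ∀ {σ a b} → σ a ≡ σ b → missing σ a ≡ missing σ b
  missing-cong {σ} {a} {b} σa≡σb =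
    cong head (List.filter-≐ (T? ∘ missesᵇ σ a) (T? ∘ missesᵇ σ b)
                (transfer σa≡σb , transfer (sym σa≡σb)) (allFinL n))
    where
    transfer : ∀ {x y j} → σ x ≡ σ y → T (missesᵇ σ x j) → T (missesᵇ σ y j)
    transfer {x} {y} {j} σx≡σy t = missesᵇ-complete σ avoids
      where
      avoids : ∀ {k} → k ≢ y → σ k ≢ j
      avoids {k} k≢y with k ≟ x
      ... | no k≢x = missesᵇ-sound σ t k≢x
      ... | yes refl = λ σx≡j → missesᵇ-sound σ t (k≢y ∘ sym) (trans (sym σx≡σy) σx≡j)

module _ {G : Graph} {n : ℕ} where

  ClassConstant : BRel n → PMap G n → Set
  ClassConstant R K = ∀ {i j} → rel R i j → lookup K i ≡ lookup K j

  Coherent : BRel n → PMap G n → Set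
  Coherent R K = ∀ {i j} → rel R i j → IsJust (lookup K i) → IsJust (lookup K j) → lookup K i ≡ lookup K j

  PairClass : PMap G n → BRel n → Set
  PairClass K R = ∃[ i ] ∃[ j ] (i ≢ j × rel R i j
    × (∀ k → rel R i k → k ≡ i ⊎ k ≡ j)
    × (∀ k → (IsJust (lookup K k) → k ≡ i ⊎ k ≡ j) × (k ≡ i ⊎ k ≡ j → IsJust (lookup K k)))
    × lookup K i ≡ lookup K j)

  pairClass⇒classConstant : ∀ {K R} → IsEquivRel R → PairClass K R → ClassConstant R K
  pairClass⇒classConstant {K} {R} (refl′ , sym′ , trans′) (a , b , _ , rab , class-of-a , dom , Ka≡Kb) {i} {j} r =
    by-membership (i ≟ a ⊎-dec i ≟ b)
    where
    InPair : Fin n → Set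
    InPair k = k ≡ a ⊎ k ≡ b
    related-to-a : ∀ {k} → InPair k → rel R a k
    related-to-a (inj₁ refl) = refl′ a
    related-to-a (inj₂ refl) = rab
    stays : ∀ {k l} → rel R k l → InPair k → InPair l
    stays {k} {l} r k∈ab = class-of-a l (trans′ a k l (related-to-a k∈ab) r)
    value : ∀ {k} → InPair k → lookup K k ≡ lookup K a
    value (inj₁ refl) = refl
    value (inj₂ refl) = sym Ka≡Kb
    outside : ∀ {k} → ¬ InPair k → lookup K k ≡ nothing
    outside {k} k∉ab with lookup K k | proj₁ (dom k)
    ... | nothing | _ = refl
    ... | just p | in-dom = ⊥-elim (k∉ab (in-dom (p , refl)))
    by-membership : Dec (InPair i) → lookup K i ≡ lookup K j
    by-membership (yes i∈ab) = trans (value i∈ab) (sym (value (stays r i∈ab)))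
    by-membership (no i∉ab) = trans (outside i∉ab) (sym (outside (i∉ab ∘ stays (sym′ i j r))))

  atom⇒classConstant : ∀ {K R} → IsAtom G n (K , R) → ClassConstant R K
  atom⇒classConstant {K} {R} (eqv , _ , pair , none) {i} {j} r with numClasses R ℕ.≟ n
  ... | yes c = cong (lookup K) (numClasses≡n⇒discrete {R = R} eqv c r)
  ... | no c≢n with numClasses R ℕ.≟ n ∸ 1
  ...   | yes c = pairClass⇒classConstant {K} {R} eqv (pair c) r
  ...   | no c≢n∸1 = trans (none c≢n c≢n∸1 i) (sym (none c≢n c≢n∸1 j))

  classConstant⇒coherent : ∀ {K R} → ClassConstant R K → Coherent R K
  classConstant⇒coherent K-const r _ _ = K-const r

  NonIndependent-reindex : ∀ {K₁ K₂ : PMap G n} (σ : Fin n → Fin n) → (∀ m → ∃[ k ] σ k ≡ m) →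
    (∀ i → lookup K₂ i ≡ lookup K₁ (σ i)) → NonIndependent {G} K₁ → NonIndependent {G} K₂
  NonIndependent-reindex σ σ-surj K₂≡K₁∘σ (c , d , p , q , K₁c≡p , K₁d≡q , p~q)
    with i , refl ← σ-surj c | j , refl ← σ-surj d =
    i , j , p , q , trans (K₂≡K₁∘σ i) K₁c≡p , trans (K₂≡K₁∘σ j) K₁d≡q , p~q

  subK-just : ∀ {σ : Fin n → Fin n} {K : PMap G n} {R : BRel n} {i p} →
    lookup (subK {G} σ (K , R)) i ≡ just p →
    T (distinguishingᵇ (subRel σ R) i) × ∃[ m ] (missing σ i ≡ just m × lookup K m ≡ just p)
  subK-just {σ} {K} {R} {i} {p} e =
    decode (distinguishingᵇ (subRel σ R) i) (missing σ i) (trans (sym (Vec.lookup∘tabulate _ i)) e)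
    where
    decode : ∀ d mm → (if d then Maybe.maybe (lookup K) nothing mm else nothing) ≡ just p →
      T d × ∃[ m ] (mm ≡ just m × lookup K m ≡ just p)
    decode true (just m) e = tt , m , refl , e
    decode true nothing ()
    decode false _ ()

  sub-nonIndependent : ∀ {σ : Fin n → Fin n} {K : PMap G n} {R : BRel n} →
    3 ≤ n → IsAtom G n (K , R) →
    (∀ i → IsJust (lookup (subK {G} σ (K , R)) i)) → NonIndependent {G} (subK {G} σ (K , R))
  sub-nonIndependent {σ} {K} {R} n≥3 (eqv , total , _) defined =
    NonIndependent-reindex {K₁ = K} {K₂ = subK {G} σ (K , R)} σ σ-surj Kσ≡K∘σ
      (proj₂ (total (discrete⇒numClasses≡n {R = R} R-discrete)))
    where
    everywhere-distinguishing : ∀ i → T (distinguishingᵇ (subRel σ R) i)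
    everywhere-distinguishing i = proj₁ (subK-just {σ} {K} {R} (proj₂ (defined i)))
    S-discrete : Discrete (subRel σ R)
    S-discrete = everywhere-distinguishing⇒discrete {S = subRel σ R} n≥3 everywhere-distinguishing
    σ-inj : Injective _≡_ _≡_ σ
    σ-inj {j} {k} σj≡σk = S-discrete (subRel-identifies σ R {j} {k} eqv σj≡σk)
    σ-surj : ∀ m → ∃[ k ] σ k ≡ m
    σ-surj = injective⇒surjective σ-inj
    R-discrete : Discrete R
    R-discrete {u} {v} r with j , refl ← σ-surj u | k , refl ← σ-surj v =
      cong σ (S-discrete {j} {k} (trans (relᵇ-subRel σ R j k) r))
    Kσ≡K∘σ : ∀ i → lookup (subK {G} σ (K , R)) i ≡ lookup K (σ i)
    Kσ≡K∘σ i
      with p , Kσi≡p ← defined i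
      with _ , m , missing≡m , Km≡p ← subK-just {σ} {K} {R} Kσi≡p
      with refl ← missing-injective {σ = σ} σ-inj missing≡m = trans Kσi≡p (sym Km≡p)

  sub-coherent : ∀ {σ : Fin n → Fin n} {K : PMap G n} {R : BRel n} → IsAtom G n (K , R) →
    Coherent (subRel σ R) (subK {G} σ (K , R))
  sub-coherent {σ} {K} {R} at@(eqv , _) {a} {b} r (pa , Kσa≡pa) (pb , Kσb≡pb)
    with da , ma , missing≡ma , Kma≡pa ← subK-just {σ} {K} {R} Kσa≡pa
       | db , mb , missing≡mb , Kmb≡pb ← subK-just {σ} {K} {R} Kσb≡pb = begin
    lookup (subK {G} σ (K , R)) a ≡⟨ Kσa≡pa ⟩
    just pa                       ≡⟨ Kma≡pa ⟨
    lookup K ma                   ≡⟨ same-value (σ a ≟ σ b) ⟩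
    lookup K mb                   ≡⟨ Kmb≡pb ⟩
    just pb                       ≡⟨ Kσb≡pb ⟨
    lookup (subK {G} σ (K , R)) b ∎
    where
    open ≡-Reasoning
    same-value : Dec (σ a ≡ σ b) → lookup K ma ≡ lookup K mb
    same-value (yes σa≡σb) =
      cong (lookup K) (just-injective (trans (sym missing≡ma) (trans (missing-cong {σ = σ} σa≡σb) missing≡mb)))
    same-value (no σa≢σb) = by-injectivity (two-distinguishing⇒injective {σ = σ} {R} eqv da db σa≢σb)
      where
      by-injectivity : Injective _≡_ _≡_ σ → lookup K ma ≡ lookup K mb
      by-injectivity σ-inj
        with refl ← missing-injective {σ = σ} σ-inj missing≡ma
           | refl ← missing-injective {σ = σ} σ-inj missing≡mb =
        atom⇒classConstant {K} {R} at (trans (sym (relᵇ-subRel σ R a b)) r)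

module Hat {n : ℕ} {Γ Δ : Graph} (f : V Γ → V Δ) where

  private
    F : Vx Γ n → Vx Δ n
    F = f× {Γ} {Δ} {n} f

    mapK : PMap Γ n → PMap Δ n
    mapK = Vec.map (Maybe.map F)

  f̂ : Raw Γ n → Raw Δ n
  f̂ = fhat {Γ} {Δ} {n} f

  infix 4 _Lifts_
  record _Lifts_ (K : PMap Γ n) (K′ : PMap Δ n) : Set where
    field
      lifts-at : ∀ k → Maybe.map F (lookup K k) ≡ lookup K′ k
  open _Lifts_ public

  Lifts-map : ∀ K → K Lifts mapK K
  lifts-at (Lifts-map K) k = sym (Vec.lookup-map k (Maybe.map F) K)

  Lifts⇒fhat≡ : ∀ {K K′} R → K Lifts K′ → f̂ (K , R) ≡ (K′ , R)
  Lifts⇒fhat≡ {K} R K↑K′ =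
    cong (_, R) (lookup-ext λ k → trans (Vec.lookup-map k (Maybe.map F) K) (lifts-at K↑K′ k))

  module _ {K : PMap Γ n} {K′ : PMap Δ n} (K↑K′ : K Lifts K′) where

    Lifts-IsJust⁺ : ∀ {k} → IsJust (lookup K k) → IsJust (lookup K′ k)
    Lifts-IsJust⁺ {k} = subst IsJust (lifts-at K↑K′ k) ∘ IsJust-map⁺

    Lifts-IsJust⁻ : ∀ {k} → IsJust (lookup K′ k) → IsJust (lookup K k)
    Lifts-IsJust⁻ {k} = IsJust-map⁻ ∘ subst IsJust (sym (lifts-at K↑K′ k))

    Lifts-PairClass⁺ : ∀ {R} → PairClass {Γ} K R → PairClass {Δ} K′ R
    Lifts-PairClass⁺ (a , b , a≢b , rab , class-of-a , dom , Ka≡Kb) =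
      a , b , a≢b , rab , class-of-a ,
      (λ k → proj₁ (dom k) ∘ Lifts-IsJust⁻ , Lifts-IsJust⁺ ∘ proj₂ (dom k)) ,
      trans (sym (lifts-at K↑K′ a)) (trans (cong (Maybe.map F) Ka≡Kb) (lifts-at K↑K′ b))

    Lifts-PairClass⁻ : ∀ {R} → Coherent {Γ} R K → PairClass {Δ} K′ R → PairClass {Γ} K R
    Lifts-PairClass⁻ coherent (a , b , a≢b , rab , class-of-a , dom , _) =
      a , b , a≢b , rab , class-of-a ,
      (λ k → proj₁ (dom k) ∘ Lifts-IsJust⁺ , Lifts-IsJust⁻ ∘ proj₂ (dom k)) ,
      coherent rab (Lifts-IsJust⁻ (proj₂ (dom a) (inj₁ refl))) (Lifts-IsJust⁻ (proj₂ (dom b) (inj₂ refl)))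

    Lifts-NonIndependent⁺ : (∀ x y → E Γ x y → E Δ (f x) (f y)) →
      NonIndependent {Γ} K → NonIndependent {Δ} K′
    Lifts-NonIndependent⁺ hom (a , b , p , q , Ka≡p , Kb≡q , p~q) =
      a , b , F p , F q ,
      trans (sym (lifts-at K↑K′ a)) (cong (Maybe.map F) Ka≡p) ,
      trans (sym (lifts-at K↑K′ b)) (cong (Maybe.map F) Kb≡q) ,
      map₁ (hom _ _) p~q

    Lifts-IsAtom⁺ : ∀ {R} → (∀ x y → E Γ x y → E Δ (f x) (f y)) →
      IsAtom Γ n (K , R) → IsAtom Δ n (K′ , R)
    Lifts-IsAtom⁺ {R} hom (eqv , total , pair , none) =
      eqv ,
      (λ c → (λ k → Lifts-IsJust⁺ (proj₁ (total c) k)) , Lifts-NonIndependent⁺ hom (proj₂ (total c))) ,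
      Lifts-PairClass⁺ {R} ∘ pair ,
      (λ c₁ c₂ k → trans (sym (lifts-at K↑K′ k)) (cong (Maybe.map F) (none c₁ c₂ k)))

    Lifts-IsAtom⁻ : ∀ {R} → IsAtom Δ n (K′ , R) →
      (numClasses R ≡ n → NonIndependent {Γ} K) → (numClasses R ≡ n ∸ 1 → Coherent {Γ} R K) →
      IsAtom Γ n (K , R)
    Lifts-IsAtom⁻ {R} (eqv , total , pair , none) nonIndependent coherent =
      eqv ,
      (λ c → (λ k → Lifts-IsJust⁻ (proj₁ (total c) k)) , nonIndependent c) ,
      (λ c → Lifts-PairClass⁻ {R} (coherent c) (pair c)) ,
      (λ c₁ c₂ k → map-nothing⁻ (trans (lifts-at K↑K′ k) (none c₁ c₂ k)))

  fhat-preserves-atoms : (∀ x y → E Γ x y → E Δ (f x) (f y)) →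
    ∀ {a : Raw Γ n} → IsAtom Γ n a → IsAtom Δ n (f̂ a)
  fhat-preserves-atoms hom {K , R} = Lifts-IsAtom⁺ (Lifts-map K) {R} hom

  fhat-sub : ∀ σ (y : Raw Γ n) → sub {Δ} σ (f̂ y) ≡ f̂ (sub {Γ} σ y)
  fhat-sub σ (K , R) = cong (_, subRel σ R) (lookup-ext pointwise)
    where
    commute : ∀ d mm →
      (if d then Maybe.maybe (lookup (mapK K)) nothing mm else nothing)
        ≡ Maybe.map F (if d then Maybe.maybe (lookup K) nothing mm else nothing)
    commute false _ = refl
    commute true nothing = refl
    commute true (just m) = Vec.lookup-map m (Maybe.map F) K
    pointwise : ∀ i → lookup (subK {Δ} σ (mapK K , R)) i
                    ≡ lookup (mapK (subK {Γ} σ (K , R))) i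
    pointwise i = trans (Vec.lookup∘tabulate _ i)
      (trans (commute (distinguishingᵇ (subRel σ R) i) (missing σ i))
        (trans (cong (Maybe.map F) (sym (Vec.lookup∘tabulate _ i))) (lifts-at (Lifts-map (subK {Γ} σ (K , R))) i)))

  fhat-preserves-≡ᵢ : ∀ i {x y : Raw Γ n} → Cᵣ {Γ} i x y →
    Cᵣ {Δ} i (f̂ x) (f̂ y)
  fhat-preserves-≡ᵢ i {K , _} {K₂ , _} (Ki≡K₂i , agree) =
    trans (sym (lifts-at (Lifts-map K) i)) (trans (cong (Maybe.map F) Ki≡K₂i) (lifts-at (Lifts-map K₂) i)) , agree

  fhat-preserves-sub : ∀ σ {x y : Raw Γ n} → Sᵣ {Γ} σ x y →
    Sᵣ {Δ} σ (f̂ x) (f̂ y)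
  fhat-preserves-sub σ {y = y} e = trans (fhat-sub σ y) (cong (f̂) e)

  fhat-reflects-sub : ∀ σ {x′ : Raw Δ n} {y : Raw Γ n} → 3 ≤ n → IsAtom Δ n x′ → IsAtom Γ n y →
    Sᵣ {Δ} σ x′ (f̂ y) →
    ∃[ x ] (IsAtom Γ n x × Sᵣ {Γ} σ x y × f̂ x ≡ x′)
  fhat-reflects-sub σ {x′} {y@(K , R)} n≥3 at′ at e =
    sub {Γ} σ y , sub-atom , refl , trans (sym (fhat-sub σ y)) e
    where
    image-atom : IsAtom Δ n (f̂ (sub {Γ} σ y))
    image-atom = subst (IsAtom Δ n) (trans (sym e) (fhat-sub σ y)) at′
    Kσ : PMap Γ n
    Kσ = subK {Γ} σ y
    sub-atom : IsAtom Γ n (sub {Γ} σ y)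
    sub-atom = Lifts-IsAtom⁻ (Lifts-map Kσ) {subRel σ R} image-atom
      (λ c → sub-nonIndependent {G = Γ} {σ = σ} {K = K} {R = R} n≥3 at
               (λ k → Lifts-IsJust⁻ (Lifts-map Kσ) (proj₁ (proj₁ (proj₂ image-atom) c) k)))
      (λ _ → sub-coherent {G = Γ} {σ = σ} {K = K} {R = R} at)

  module _ (pm : IsGraphPMorphism Γ Δ f) (surj : IsSurjective f) where

    liftM : Maybe (Vx Δ n) → Maybe (Vx Γ n)
    liftM = Maybe.map λ (y , l) → proj₁ (surj y) , l

    liftM-section : ∀ m → Maybe.map F (liftM m) ≡ m
    liftM-section nothing = refl
    liftM-section (just (y , l)) = cong (λ x → just (x , l)) (proj₂ (surj y))

    -- Re-lifts the endpoint o of an edge along the back condition at the lift of c.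
    lift-along-edge : ∀ {K₀ K′ c o pc po} → K₀ Lifts K′ → c ≢ o →
      lookup K′ c ≡ just pc → lookup K′ o ≡ just po → E Δ (proj₁ pc) (proj₁ po) →
      ∃[ K ] (K Lifts K′ × (∀ {k} → k ≢ o → lookup K k ≡ lookup K₀ k) × NonIndependent {Γ} K)
    lift-along-edge {K₀} {K′} {c} {o} {pc} {y′ , l′} K₀↑K′ c≢o K′c≡pc K′o≡po edge
      with (x , l) , K₀c≡xl , Fxl≡pc ← map-just⁻ {h = F} (trans (lifts-at K₀↑K′ c) K′c≡pc)
      with x′ , x~x′ , fx′≡y′ ← proj₂ (pm x) y′ (subst (λ z → E Δ z y′) (cong proj₁ (sym Fxl≡pc)) edge) =
      K , K↑K′ , unchanged ,
      c , o , (x , l) , (x′ , l′) , trans (unchanged c≢o) K₀c≡xl , Vec.lookup∘update o K₀ _ , inj₁ x~x′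
      where
      K : PMap Γ n
      K = K₀ [ o ]≔ just (x′ , l′)
      unchanged : ∀ {k} → k ≢ o → lookup K k ≡ lookup K₀ k
      unchanged k≢o = Vec.lookup∘update′ k≢o K₀ _
      K↑K′ : K Lifts K′
      lifts-at K↑K′ k with k ≟ o
      ... | yes refl =
        trans (cong (Maybe.map F) (Vec.lookup∘update o K₀ _))
              (trans (cong (λ y → just (y , l′)) fx′≡y′) (sym K′o≡po))
      ... | no k≢o = trans (cong (Maybe.map F) (unchanged k≢o)) (lifts-at K₀↑K′ k)

    lift-nonIndependent : ∀ {K₀ K′} → K₀ Lifts K′ → NonIndependent {Δ} K′ → ∀ i →
      ∃[ K ] (K Lifts K′ × lookup K i ≡ lookup K₀ i × NonIndependent {Γ} K)
    lift-nonIndependent {K₀} K₀↑K′ (a , b , p , q , K′a≡p , K′b≡q , inj₂ colours≢) i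
      with pa , K₀a≡pa , Fpa≡p ← map-just⁻ {h = F} (trans (lifts-at K₀↑K′ a) K′a≡p)
         | pb , K₀b≡pb , Fpb≡q ← map-just⁻ {h = F} (trans (lifts-at K₀↑K′ b) K′b≡q) =
      K₀ , K₀↑K′ , refl , a , b , pa , pb , K₀a≡pa , K₀b≡pb ,
      inj₂ λ e → colours≢ (trans (cong proj₂ (sym Fpa≡p)) (trans e (cong proj₂ Fpb≡q)))
    lift-nonIndependent K₀↑K′ (a , b , p , q , K′a≡p , K′b≡q , inj₁ edge) i with a ≟ b | b ≟ i
    ... | yes refl | _ =
      ⊥-elim (E-irr Δ (proj₁ p) (subst (λ z → E Δ (proj₁ p) (proj₁ z)) (sym p≡q) edge))
      where
      p≡q : p ≡ q
      p≡q = just-injective (trans (sym K′a≡p) K′b≡q)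
    -- re-lift the endpoint that is not i, so that the value at i is kept
    ... | no a≢b | no b≢i =
      let K , K↑K′ , unchanged , independent = lift-along-edge K₀↑K′ a≢b K′a≡p K′b≡q edge
      in K , K↑K′ , unchanged (b≢i ∘ sym) , independent
    ... | no a≢b | yes refl =
      let K , K↑K′ , unchanged , independent =
            lift-along-edge K₀↑K′ (a≢b ∘ sym) K′b≡q K′a≡p (E-sym Δ edge)
      in K , K↑K′ , unchanged (a≢b ∘ sym) , independent

    classLift : BRel n → Fin n → Maybe (Vx Γ n) → PMap Δ n → PMap Γ n
    classLift R i m K′ = tabulate λ k → if relᵇ R i k then m else liftM (lookup K′ k)

    module _ {R : BRel n} {i : Fin n} {m : Maybe (Vx Γ n)} {K′ : PMap Δ n} where

      private
        lookup-classLift : ∀ k → lookup (classLift R i m K′) k ≡ (if relᵇ R i k then m else liftM (lookup K′ k))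
        lookup-classLift = Vec.lookup∘tabulate _

      classLift-at : IsEquivRel R → lookup (classLift R i m K′) i ≡ m
      classLift-at (refl′ , _) rewrite lookup-classLift i | refl′ i = refl

      classLift-Lifts : ClassConstant {Δ} R K′ → Maybe.map F m ≡ lookup K′ i → classLift R i m K′ Lifts K′
      lifts-at (classLift-Lifts K′-const Fm≡K′i) k rewrite lookup-classLift k with relᵇ R i k in r
      ... | true = trans Fm≡K′i (K′-const r)
      ... | false = liftM-section (lookup K′ k)

      classLift-classConstant : IsEquivRel R → ClassConstant {Δ} R K′ → ClassConstant {Γ} R (classLift R i m K′)
      classLift-classConstant (_ , sym′ , trans′) K′-const {a} {b} r
        rewrite lookup-classLift a | lookup-classLift b
        with relᵇ R i a in ra | relᵇ R i b in rb
      ... | true | true = refl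
      ... | false | false = cong liftM (K′-const r)
      ... | true | false = ⊥-elim (false≢true (trans (sym rb) (trans′ i a b ra r)))
      ... | false | true = ⊥-elim (false≢true (trans (sym ra) (trans′ i b a rb (sym′ a b r))))

    lift-atom : ∀ {K′ R} → IsAtom Δ n (K′ , R) → ∀ i {m} → Maybe.map F m ≡ lookup K′ i →
      ∃[ K ] (IsAtom Γ n (K , R) × f̂ (K , R) ≡ (K′ , R) × lookup K i ≡ m)
    lift-atom {K′} {R} at@(eqv , total , _) i {m} Fm≡K′i = by-count (numClasses R ℕ.≟ n)
      where
      K′-const : ClassConstant {Δ} R K′
      K′-const = atom⇒classConstant {G = Δ} {K = K′} {R = R} at
      K₁ : PMap Γ n
      K₁ = classLift R i m K′
      K₁↑K′ : K₁ Lifts K′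
      K₁↑K′ = classLift-Lifts {R} {i} {m} {K′} K′-const Fm≡K′i
      by-count : Dec (numClasses R ≡ n) →
        ∃[ K ] (IsAtom Γ n (K , R) × f̂ (K , R) ≡ (K′ , R) × lookup K i ≡ m)
      by-count (yes c) =
        let K , K↑K′ , Ki≡K₁i , independent = lift-nonIndependent K₁↑K′ (proj₂ (total c)) i
        in K , Lifts-IsAtom⁻ K↑K′ {R} at (λ _ → independent) (⊥-elim ∘ n≢n∸1 i ∘ trans (sym c)) ,
           Lifts⇒fhat≡ R K↑K′ , trans Ki≡K₁i (classLift-at {R} {i} {m} {K′} eqv)
      by-count (no c≢n) =
        K₁ , Lifts-IsAtom⁻ K₁↑K′ {R} at (⊥-elim ∘ c≢n)
               (λ _ → classConstant⇒coherent {G = Γ} {K = K₁} {R = R}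
                        (classLift-classConstant {R} {i} {m} {K′} eqv K′-const)) ,
        Lifts⇒fhat≡ R K₁↑K′ , classLift-at {R} {i} {m} {K′} eqv

    fhat-onto-atoms : Fin n → ∀ {b} → IsAtom Δ n b → ∃[ a ] (IsAtom Γ n a × f̂ a ≡ b)
    fhat-onto-atoms i {K′ , R} at =
      let K , atom , image , _ = lift-atom at i {liftM (lookup K′ i)} (liftM-section (lookup K′ i))
      in (K , R) , atom , image

    fhat-reflects-≡ᵢ : ∀ i {x′ : Raw Δ n} {y : Raw Γ n} → IsAtom Δ n x′ → Cᵣ {Δ} i x′ (f̂ y) →
      ∃[ x ] (IsAtom Γ n x × Cᵣ {Γ} i x y × f̂ x ≡ x′)
    fhat-reflects-≡ᵢ i {K′ , R′} {K , _} at (K′i≡ , agree) =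
      let Kx , atom , image , Kxi≡Ki = lift-atom at i (trans (lifts-at (Lifts-map K) i) (sym K′i≡))
      in (Kx , R′) , atom , (Kxi≡Ki , agree) , image

lemma8p7 : (n : ℕ) → 3 ≤ n → (Γ Δ : Graph) (f : V Γ → V Δ) →
    IsGraphPMorphism Γ Δ f → IsSurjective f →
    (∀ a → IsAtom Γ n a → IsAtom Δ n (fhat {Γ} {Δ} {n} f a))
    × (∀ b → IsAtom Δ n b → ∃[ a ] (IsAtom Γ n a × fhat {Γ} {Δ} {n} f a ≡ b))
    × IsAtPMorphism Γ Δ n (fhat {Γ} {Δ} {n} f)
lemma8p7 n n≥3 Γ Δ f pm surj =
  (λ a → fhat-preserves-atoms (proj₁ ∘ pm) {a}) ,
  (λ _ → fhat-onto-atoms pm surj (fromℕ< n≥3)) ,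
  (λ _ _ _ _ d → d) , (λ _ _ _ _ d → d) ,
  (λ i x y _ _ → fhat-preserves-≡ᵢ i {x} {y}) ,
  (λ i x′ y at′ _ → fhat-reflects-≡ᵢ pm surj i {x′} {y} at′) ,
  (λ σ x y _ _ → fhat-preserves-sub σ {x} {y}) ,
  (λ σ x′ y at′ at → fhat-reflects-sub σ {x′} {y} n≥3 at′ at)
  where open Hat {n} {Γ} {Δ} f
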